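{- Let $(G,\mathcal{H})$ be a non-piercing graph system where $G$ is outerplanar and embedded in the plane with all vertices on the outer face, and let $C$ be the cycle defining the outer face of $G$. Then $(C,\mathcal{H})$ is $axax$-free.
   Context: $(G,\mathcal{H})$ is non-piercing if each $H\in\mathcal{H}$ is connected and for any $H,H'\in\mathcal{H}$, the subgraph of $H$ induced by the vertices of $H$ not in $H'$ is connected. Each $H$ is regarded as a (possibly disconnected) subgraph of $C$ via its vertices on $C$. $(C,\mathcal{H})$ is $axax$-free if for no two $H,H'\in\mathcal{H}$ are there four vertices $a_1,x_1,a_2,x_2$ in this cyclic order around $C$ with $a_1,a_2\in H\setminus H'$ and $x_1,x_2\in H'$. -}

module Defs where

open import Data.Nat using (ℕ; zero; suc; _<_; _≤_; _∸_)
open import Data.Fin using (Fin; toℕ)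
open import Data.Product using (_×_)
open import Data.Sum using (_⊎_)
open import Data.Empty using (⊥)
open import Relation.Nullary using (¬_)
open import Relation.Binary.PropositionalEquality using (_≡_)

Graph : ℕ → Set₁
Graph n = Fin n → Fin n → Set

VSet : ℕ → Set₁
VSet n = Fin n → Set

_∖_ : ∀ {n} → VSet n → VSet n → VSet n
(S ∖ T) v = S v × ¬ T v

data Reach {n} (E : Graph n) (S : VSet n) (u : Fin n) : Fin n → Set where
  here : S u → Reach E S u u
  step : ∀ {v w} → Reach E S u v → E v w → S w → Reach E S u w

-- The induced subgraph G[S] is connected (the empty set counts as connected).
Connected : ∀ {n} → Graph n → VSet n → Set
Connected E S = ∀ u v → S u → S v → Reach E S u v

Symmetric : ∀ {n} → Graph n → Set
Symmetric E = ∀ u v → E u v → E v u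

-- G contains the Hamiltonian cycle C = 0,1,...,n-1,0 (vertices numbered in the
-- order they appear along the boundary of the outer face).
ContainsCycle : ∀ {n} → Graph n → Set
ContainsCycle {n} E =
  (∀ i j → toℕ j ≡ suc (toℕ i) → E i j) ×
  (∀ i j → toℕ i ≡ 0 → toℕ j ≡ n ∸ 1 → E j i)

NonCrossing : ∀ {n} → Graph n → Set
NonCrossing {n} E = ∀ (a b c d : Fin n) →
  toℕ a < toℕ b → toℕ b < toℕ c → toℕ c < toℕ d → E a c → E b d → ⊥

-- (G, C) : G is an outerplanar graph embedded with all vertices on the outer
-- face, whose boundary is the cycle C = 0,1,...,n-1,0.
OuterplaneWithOuterCycle : ∀ {n} → Graph n → Set
OuterplaneWithOuterCycle {n} E = (3 ≤ n) × Symmetric E × ContainsCycle E × NonCrossing E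

CyclicOrder4 : ∀ {n} → Fin n → Fin n → Fin n → Fin n → Set
CyclicOrder4 p q r s =
  let P = toℕ p ; Q = toℕ q ; R = toℕ r ; S = toℕ s in
  (P < Q × Q < R × R < S) ⊎ (Q < R × R < S × S < P) ⊎
  (R < S × S < P × P < Q) ⊎ (S < P × P < Q × Q < R)

NonPiercing : ∀ {n} {I : Set} → Graph n → (I → VSet n) → Set
NonPiercing E ℋ = (∀ i → Connected E (ℋ i)) × (∀ i j → Connected E (ℋ i ∖ ℋ j))

AxaxFree : ∀ {n} {I : Set} → (I → VSet n) → Set
AxaxFree {n} {I} ℋ = ∀ (i j : I) (a₁ x₁ a₂ x₂ : Fin n) →
  CyclicOrder4 a₁ x₁ a₂ x₂ →
  (ℋ i ∖ ℋ j) a₁ → (ℋ i ∖ ℋ j) a₂ → ℋ j x₁ → ℋ j x₂ → ⊥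

{-# OPTIONS --safe #-}
module Submission where

-- Number the vertices 0, …, n-1 along C. Say that an edge pq separates
-- two vertices when exactly one of them lies strictly between p and q. In an
-- outerplane graph no edge separates the endpoints of an edge disjoint from
-- it, so no path avoiding p and q connects two vertices separated by pq.
-- Now if a₁, x₁, a₂, x₂ occur in this cyclic order, with a₁, a₂ ∈ H ∖ H′ and
-- x₁, x₂ ∈ H′, then x₁x₂ separates a₁ from a₂, so the path from a₁ to a₂ inside
-- H ∖ H′ has an edge st separating x₁ from x₂; but then the path from x₁ to x₂
-- inside H′ is disjoint from s and t and connects two vertices separated by st.

open import Data.Nat using (ℕ; _<_)
open import Data.Nat.Properties using (<-cmp; <-trans; <-asym; _<?_)
open import Data.Fin using (Fin; toℕ)
open import Data.Fin.Properties using (toℕ-injective)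
open import Data.Product using (_×_; _,_; ∃₂; proj₂)
open import Data.Sum using (_⊎_; inj₁; inj₂)
open import Data.Empty using (⊥-elim)
open import Function using (_∘_)
open import Relation.Nullary using (¬_; Dec; yes; no)
open import Relation.Nullary.Decidable using (_×-dec_; _⊎-dec_)
open import Relation.Unary using (Decidable)
open import Relation.Binary.PropositionalEquality using (_≢_; ≢-sym; subst)
open import Relation.Binary.Definitions using (tri<; tri≈; tri>)
open import Defs

Separated : {A : Set} → (A → Set) → A → A → Set
Separated P a c = (P a × ¬ P c) ⊎ (¬ P a × P c)

module _ {A : Set} {P : A → Set} where

  separated-sym : ∀ {a c} → Separated P a c → Separated P c a
  separated-sym (inj₁ (Pa , ¬Pc)) = inj₂ (¬Pc , Pa)
  separated-sym (inj₂ (¬Pa , Pc)) = inj₁ (Pc , ¬Pa)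

  separated-irrefl : ∀ {a} → ¬ Separated P a a
  separated-irrefl (inj₁ (Pa , ¬Pa)) = ¬Pa Pa
  separated-irrefl (inj₂ (¬Pa , Pa)) = ¬Pa Pa

  separated-split : ∀ {a b c} → Separated P a c → Dec (P b) →
                    Separated P a b ⊎ Separated P b c
  separated-split (inj₁ (Pa , ¬Pc)) (yes Pb) = inj₂ (inj₁ (Pb , ¬Pc))
  separated-split (inj₁ (Pa , ¬Pc)) (no ¬Pb) = inj₁ (inj₁ (Pa , ¬Pb))
  separated-split (inj₂ (¬Pa , Pc)) (yes Pb) = inj₁ (inj₂ (¬Pa , Pb))
  separated-split (inj₂ (¬Pa , Pc)) (no ¬Pb) = inj₂ (inj₂ (¬Pb , Pc))

Between : ℕ → ℕ → ℕ → Set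
Between p q w = (p < w × w < q) ⊎ (q < w × w < p)

between? : ∀ p q → Decidable (Between p q)
between? p q w = ((p <? w) ×-dec (w <? q)) ⊎-dec ((q <? w) ×-dec (w <? p))

between-sym : ∀ {p q w} → Between p q w → Between q p w
between-sym (inj₁ pwq) = inj₂ pwq
between-sym (inj₂ qwp) = inj₁ qwp

Separates : ℕ → ℕ → ℕ → ℕ → Set
Separates p q = Separated (Between p q)

separates-sym : ∀ {p q a c} → Separates p q a c → Separates q p a c
separates-sym (inj₁ (pq , ¬pq)) = inj₁ (between-sym pq , ¬pq ∘ between-sym)
separates-sym (inj₂ (¬pq , pq)) = inj₂ (¬pq ∘ between-sym , between-sym pq)

separates-outside : ∀ {a b c d} → a < c → c < b → ¬ Between a b d →
                    d ≢ a → d ≢ b → Separates c d a b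
separates-outside {a} {b} {c} {d} a<c c<b d∉ab d≢a d≢b with <-cmp d a
... | tri< d<a _ _ = inj₁ (inj₂ (d<a , a<c) , λ
  { (inj₁ (_ , b<d)) → <-asym b<d (<-trans d<a (<-trans a<c c<b))
  ; (inj₂ (_ , b<c)) → <-asym b<c c<b })
... | tri≈ _ d≡a _ = ⊥-elim (d≢a d≡a)
... | tri> _ _ a<d with <-cmp d b
...   | tri< d<b _ _ = ⊥-elim (d∉ab (inj₁ (a<d , d<b)))
...   | tri≈ _ d≡b _ = ⊥-elim (d≢b d≡b)
...   | tri> _ _ b<d = inj₂ ((λ { (inj₁ (c<a , _)) → <-asym c<a a<c
                                ; (inj₂ (d<a , _)) → <-asym d<a a<d })
                           , inj₁ (c<b , b<d))

separates-between : ∀ {a b c d} → Between a b c → ¬ Between a b d →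
                    d ≢ a → d ≢ b → Separates c d a b
separates-between (inj₁ (a<c , c<b)) d∉ab d≢a d≢b =
  separates-outside a<c c<b d∉ab d≢a d≢b
separates-between (inj₂ (b<c , c<a)) d∉ab d≢a d≢b =
  separated-sym {P = Between _ _} (separates-outside b<c c<a (d∉ab ∘ between-sym) d≢b d≢a)

separates-swap : ∀ {a b c d} → c ≢ a → c ≢ b → d ≢ a → d ≢ b →
                 Separates a b c d → Separates c d a b
separates-swap c≢a c≢b d≢a d≢b (inj₁ (c∈ab , d∉ab)) =
  separates-between c∈ab d∉ab d≢a d≢b
separates-swap c≢a c≢b d≢a d≢b (inj₂ (c∉ab , d∈ab)) =
  separates-sym (separates-between d∈ab c∉ab c≢a c≢b)

cyclicOrder4⇒separates : ∀ {n} {a₁ x₁ a₂ x₂ : Fin n} → CyclicOrder4 a₁ x₁ a₂ x₂ →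
                         Separates (toℕ x₁) (toℕ x₂) (toℕ a₁) (toℕ a₂)
cyclicOrder4⇒separates (inj₁ (o₁ , o₂ , o₃)) = inj₂
  ( (λ { (inj₁ (x₁<a₁ , _)) → <-asym x₁<a₁ o₁
       ; (inj₂ (x₂<a₁ , _)) → <-asym x₂<a₁ (<-trans o₁ (<-trans o₂ o₃)) })
  , inj₁ (o₂ , o₃))
cyclicOrder4⇒separates (inj₂ (inj₁ (o₁ , o₂ , o₃))) = inj₂
  ( (λ { (inj₁ (_ , a₁<x₂)) → <-asym a₁<x₂ o₃
       ; (inj₂ (_ , a₁<x₁)) → <-asym a₁<x₁ (<-trans o₁ (<-trans o₂ o₃)) })
  , inj₁ (o₁ , o₂))
cyclicOrder4⇒separates (inj₂ (inj₂ (inj₁ (o₁ , o₂ , o₃)))) = inj₁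
  ( inj₂ (o₂ , o₃)
  , λ { (inj₁ (x₁<a₂ , _)) → <-asym x₁<a₂ (<-trans o₁ (<-trans o₂ o₃))
      ; (inj₂ (x₂<a₂ , _)) → <-asym x₂<a₂ o₁ })
cyclicOrder4⇒separates (inj₂ (inj₂ (inj₂ (o₁ , o₂ , o₃)))) = inj₁
  ( inj₂ (o₁ , o₂)
  , λ { (inj₁ (_ , a₂<x₂)) → <-asym a₂<x₂ (<-trans o₁ (<-trans o₂ o₃))
      ; (inj₂ (_ , a₂<x₁)) → <-asym a₂<x₁ o₃ })

module _ {n : ℕ} {E : Graph n} where

  reach-source : ∀ {S u v} → Reach E S u v → S u
  reach-source (here Su)     = Su
  reach-source (step r _ _) = reach-source r

  reach-target : ∀ {S u v} → Reach E S u v → S v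
  reach-target (here Sv)     = Sv
  reach-target (step _ _ Sv) = Sv

  crossing-edge : ∀ {S u v} {P : Fin n → Set} → Decidable P → Reach E S u v →
                  Separated P u v → ∃₂ λ s t → S s × S t × E s t × Separated P s t
  crossing-edge {P = P} P? (here _) sep = ⊥-elim (separated-irrefl {P = P} sep)
  crossing-edge {P = P} P? (step {v} {w} r e Sw) sep with separated-split {P = P} sep (P? v)
  ... | inj₁ sep′ = crossing-edge P? r sep′
  ... | inj₂ sep′ = v , w , reach-target r , Sw , e , sep′

module _ {n : ℕ} {E : Graph n} (sym : Symmetric E) (noncrossing : NonCrossing E) where

  ¬edge-leaves-interval : ∀ {p q s t : Fin n} → toℕ p < toℕ s → toℕ s < toℕ q →
                          ¬ Between (toℕ p) (toℕ q) (toℕ t) →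
                          toℕ t ≢ toℕ p → toℕ t ≢ toℕ q → E p q → ¬ E s t
  ¬edge-leaves-interval {p} {q} {s} {t} p<s s<q t∉pq t≢p t≢q epq est
    with <-cmp (toℕ t) (toℕ p)
  ... | tri< t<p _ _ = noncrossing t p s q t<p p<s s<q (sym s t est) epq
  ... | tri≈ _ t≡p _ = t≢p t≡p
  ... | tri> _ _ p<t with <-cmp (toℕ t) (toℕ q)
  ...   | tri< t<q _ _ = t∉pq (inj₁ (p<t , t<q))
  ...   | tri≈ _ t≡q _ = t≢q t≡q
  ...   | tri> _ _ q<t = noncrossing p s q t p<s s<q q<t epq est

  ¬edge-leaves-between : ∀ {p q s t : Fin n} → Between (toℕ p) (toℕ q) (toℕ s) →
                         ¬ Between (toℕ p) (toℕ q) (toℕ t) →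
                         toℕ t ≢ toℕ p → toℕ t ≢ toℕ q → E p q → ¬ E s t
  ¬edge-leaves-between (inj₁ (p<s , s<q)) t∉pq t≢p t≢q epq =
    ¬edge-leaves-interval p<s s<q t∉pq t≢p t≢q epq
  ¬edge-leaves-between {p} {q} (inj₂ (q<s , s<p)) t∉pq t≢p t≢q epq =
    ¬edge-leaves-interval q<s s<p (t∉pq ∘ between-sym) t≢q t≢p (sym p q epq)

  ¬edge-separated-by-edge : ∀ {p q s t : Fin n} →
                            toℕ s ≢ toℕ p → toℕ s ≢ toℕ q → toℕ t ≢ toℕ p → toℕ t ≢ toℕ q →
                            E p q → E s t → ¬ Separates (toℕ p) (toℕ q) (toℕ s) (toℕ t)
  ¬edge-separated-by-edge s≢p s≢q t≢p t≢q epq est (inj₁ (s∈pq , t∉pq)) =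
    ¬edge-leaves-between s∈pq t∉pq t≢p t≢q epq est
  ¬edge-separated-by-edge {s = s} {t} s≢p s≢q t≢p t≢q epq est (inj₂ (s∉pq , t∈pq)) =
    ¬edge-leaves-between t∈pq s∉pq s≢p s≢q epq (sym s t est)

  ¬path-separated-by-edge : ∀ {p q : Fin n} {S u v} → E p q →
                            (∀ w → S w → toℕ w ≢ toℕ p × toℕ w ≢ toℕ q) → Reach E S u v →
                            ¬ Separates (toℕ p) (toℕ q) (toℕ u) (toℕ v)
  ¬path-separated-by-edge {p} {q} epq avoids path sep
    with crossing-edge (between? (toℕ p) (toℕ q) ∘ toℕ) path sep
  ... | s , t , Ss , St , est , sep′ with avoids s Ss | avoids t St
  ...   | s≢p , s≢q | t≢p , t≢q = ¬edge-separated-by-edge s≢p s≢q t≢p t≢q epq est sep′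

  ¬disjoint-paths-interleave : ∀ {S T : VSet n} {x₁ x₂ a₁ a₂} → (∀ w → S w → ¬ T w) →
                               Reach E T x₁ x₂ → Reach E S a₁ a₂ →
                               ¬ Separates (toℕ x₁) (toℕ x₂) (toℕ a₁) (toℕ a₂)
  ¬disjoint-paths-interleave {S} {T} {x₁} {x₂} disjoint pathT pathS sep
    with crossing-edge (between? (toℕ x₁) (toℕ x₂) ∘ toℕ) pathS sep
  ... | s , t , Ss , St , est , sep′ =
    ¬path-separated-by-edge est (λ w Tw → apart Ss Tw , apart St Tw) pathT
      (separates-swap (apart′ Ss Tx₁) (apart′ Ss Tx₂) (apart′ St Tx₁) (apart′ St Tx₂) sep′)
    where
      Tx₁ : T x₁
      Tx₁ = reach-source pathT
      Tx₂ : T x₂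
      Tx₂ = reach-target pathT
      apart : ∀ {v w} → S v → T w → toℕ w ≢ toℕ v
      apart {v} Sv Tw w≡v = disjoint v Sv (subst T (toℕ-injective w≡v) Tw)
      apart′ : ∀ {v w} → S v → T w → toℕ v ≢ toℕ w
      apart′ Sv Tw = ≢-sym (apart Sv Tw)

lemma10 : (n : ℕ) (E : Graph n) (I : Set) (ℋ : I → VSet n) →
    OuterplaneWithOuterCycle E → NonPiercing E ℋ → AxaxFree ℋ
lemma10 n E I ℋ (_ , sym , _ , noncrossing) (connected , connected∖)
        i j a₁ x₁ a₂ x₂ order a₁∈ a₂∈ x₁∈ x₂∈ =
  ¬disjoint-paths-interleave sym noncrossing (λ _ → proj₂)
    (connected j x₁ x₂ x₁∈ x₂∈) (connected∖ i j a₁ a₂ a₁∈ a₂∈)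
    (cyclicOrder4⇒separates order)
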